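{- Let $k\ge 2$. Let $G$ be a graph admitting a closed neighborhood balanced $k$-coloring $c$ with $|c^{ -1}(1)|=\cdots=|c^{ -1}(k)|$, and let $H$ be a graph admitting a closed neighborhood balanced $k$-coloring $c'$ with $|c'^{ -1}(1)|=\cdots=|c'^{ -1}(k)|$. Then the join $G\vee H$ admits a closed neighborhood balanced $k$-coloring.
   Context: All graphs are finite and simple. $N[v]$ is the closed neighborhood of $v$. A closed neighborhood balanced $k$-coloring of a graph is a map $c$ from its vertex set to $\{1,\dots,k\}$ such that for every vertex $v$ the numbers $|N[v]\cap c^{ -1}(i)|$, $i=1,\dots,k$, are all equal. The join $G\vee H$ of vertex-disjoint graphs $G,H$ has vertex set $V(G)\cup V(H)$ and edge set $E(G)\cup E(H)\cup\{gh: g\in V(G),h\in V(H)\}$. -}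

module Defs where

open import Data.Nat using (ℕ; _+_)
open import Data.Bool using (Bool; true; false; _∧_; _∨_; if_then_else_)
open import Data.Fin using (Fin; splitAt; _≟_)
open import Data.Sum using (inj₁; inj₂)
open import Data.List using (List; length; filter)
open import Data.List using () renaming (allFin to allFinL)
open import Data.Fin.Base using ()
open import Relation.Binary.PropositionalEquality using (_≡_)
open import Relation.Nullary using (¬_)
open import Relation.Nullary.Decidable using (⌊_⌋)
open import Relation.Unary using (Decidable)

record Graph (n : ℕ) : Set where
  field
    adj   : Fin n → Fin n → Bool
    sym   : ∀ u v → adj u v ≡ adj v u
    irrefl : ∀ v → adj v v ≡ false
open Graph public

count : {n : ℕ} → (Fin n → Bool) → ℕ
count {n} p = length (filter (λ x → Data.Bool.T? (p x)) (allFinL n))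

inN : {n : ℕ} → Graph n → Fin n → Fin n → Bool
inN G v u = ⌊ u ≟ v ⌋ ∨ adj G v u

nbhdColorCount : {n k : ℕ} → Graph n → (Fin n → Fin k) → Fin n → Fin k → ℕ
nbhdColorCount G c v i = count (λ u → inN G v u ∧ ⌊ c u ≟ i ⌋)

IsCNBColoring : {n k : ℕ} → Graph n → (Fin n → Fin k) → Set
IsCNBColoring G c =
  ∀ v i j → nbhdColorCount G c v i ≡ nbhdColorCount G c v j

EqualClassSizes : {n k : ℕ} → (Fin n → Fin k) → Set
EqualClassSizes c = ∀ i j → count (λ u → ⌊ c u ≟ i ⌋) ≡ count (λ u → ⌊ c u ≟ j ⌋)

joinAdj : {m n : ℕ} → Graph m → Graph n → Fin (m + n) → Fin (m + n) → Bool
joinAdj {m} G H x y with splitAt m x | splitAt m y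
... | inj₁ a | inj₁ b = adj G a b
... | inj₂ a | inj₂ b = adj H a b
... | inj₁ _ | inj₂ _ = true
... | inj₂ _ | inj₁ _ = true

joinSym : {m n : ℕ} (G : Graph m) (H : Graph n) → ∀ x y → joinAdj G H x y ≡ joinAdj G H y x
joinSym {m} G H x y with splitAt m x | splitAt m y
... | inj₁ a | inj₁ b = Graph.sym G a b
... | inj₂ a | inj₂ b = Graph.sym H a b
... | inj₁ _ | inj₂ _ = Relation.Binary.PropositionalEquality.refl
... | inj₂ _ | inj₁ _ = Relation.Binary.PropositionalEquality.refl

joinIrrefl : {m n : ℕ} (G : Graph m) (H : Graph n) → ∀ x → joinAdj G H x x ≡ false
joinIrrefl {m} G H x with splitAt m x
... | inj₁ a = irrefl G a
... | inj₂ a = irrefl H a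

join : {m n : ℕ} → Graph m → Graph n → Graph (m + n)
join G H = record { adj = joinAdj G H ; sym = joinSym G H ; irrefl = joinIrrefl G H }

-- Colour the join by c on G and c′ on H.  A vertex of G sees its own closed
-- neighbourhood in G, which is balanced because c is, together with all of H,
-- which is balanced because the colour classes of c′ have equal size; the
-- vertices of H are symmetric.
module Submission where

open import Defs hiding (sym)
open import Data.Nat using (ℕ; zero; suc; _≤_; _+_)
open import Data.Nat.Properties using (+-assoc)
open import Data.Fin using (Fin; zero; suc; _↑ˡ_; _↑ʳ_; splitAt; _≟_)
open import Data.Fin.Properties using (splitAt-↑ˡ; splitAt-↑ʳ; splitAt⁻¹-↑ˡ; splitAt⁻¹-↑ʳ; ↑ˡ-injective; ↑ʳ-injective)
open import Data.Bool using (Bool; true; false; _∧_; _∨_; if_then_else_; T; T?)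
open import Data.Bool.Properties using (∨-zeroʳ)
open import Data.List using (length; filter; tabulate; allFin)
open import Data.List.Properties using (filter-≐)
open import Data.Product using (Σ; _×_; _,_)
open import Data.Sum using (inj₁; inj₂; [_,_]′)
open import Function using (_∘_; id; mk⇔)
open import Relation.Binary.PropositionalEquality
  using (_≡_; _≗_; refl; sym; trans; cong; cong₂; subst; module ≡-Reasoning)
open import Relation.Nullary.Decidable using (⌊_⌋; isYes≗does; does-⇔)

count-cong : {n : ℕ} {p q : Fin n → Bool} → p ≗ q → count p ≡ count q
count-cong {p = p} {q} p≗q =
  cong length (filter-≐ (T? ∘ p) (T? ∘ q) (p⊆q , q⊆p) (allFin _))
  where
    p⊆q : ∀ {x} → T (p x) → T (q x)
    p⊆q {x} = subst T (p≗q x)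
    q⊆p : ∀ {x} → T (q x) → T (p x)
    q⊆p {x} = subst T (sym (p≗q x))

countᵣ : {n : ℕ} → (Fin n → Bool) → ℕ
countᵣ {zero}  p = 0
countᵣ {suc n} p = (if p zero then 1 else 0) + countᵣ (p ∘ suc)

length-filter-tabulate : {n : ℕ} {A : Set} (p : A → Bool) (f : Fin n → A) →
  length (filter (T? ∘ p) (tabulate f)) ≡ countᵣ (p ∘ f)
length-filter-tabulate {zero}  p f = refl
length-filter-tabulate {suc n} p f with p (f zero)
... | true  = cong suc (length-filter-tabulate p (f ∘ suc))
... | false = length-filter-tabulate p (f ∘ suc)

count≡countᵣ : {n : ℕ} (p : Fin n → Bool) → count p ≡ countᵣ p
count≡countᵣ p = length-filter-tabulate p id

countᵣ-+ : (m : ℕ) {n : ℕ} (p : Fin (m + n) → Bool) →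
  countᵣ p ≡ countᵣ (p ∘ (_↑ˡ n)) + countᵣ (p ∘ (m ↑ʳ_))
countᵣ-+ zero    p = refl
countᵣ-+ (suc m) p rewrite countᵣ-+ m (p ∘ suc) =
  sym (+-assoc (if p zero then 1 else 0) _ _)

count-+ : (m : ℕ) {n : ℕ} (p : Fin (m + n) → Bool) →
  count p ≡ count (p ∘ (_↑ˡ n)) + count (p ∘ (m ↑ʳ_))
count-+ m {n} p = begin
  count p                                       ≡⟨ count≡countᵣ p ⟩
  countᵣ p                                      ≡⟨ countᵣ-+ m p ⟩
  countᵣ (p ∘ (_↑ˡ n)) + countᵣ (p ∘ (m ↑ʳ_))   ≡⟨ cong₂ _+_ (count≡countᵣ (p ∘ (_↑ˡ n)))
                                                            (count≡countᵣ (p ∘ (m ↑ʳ_))) ⟨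
  count (p ∘ (_↑ˡ n)) + count (p ∘ (m ↑ʳ_))     ∎
  where open ≡-Reasoning

↑-elim : {m n : ℕ} (P : Fin (m + n) → Set) →
  (∀ a → P (a ↑ˡ n)) → (∀ b → P (m ↑ʳ b)) → ∀ x → P x
↑-elim {m} P left right x with splitAt m x in eq
... | inj₁ a = subst P (splitAt⁻¹-↑ˡ eq) (left a)
... | inj₂ b = subst P (splitAt⁻¹-↑ʳ eq) (right b)

⌊≟⌋-injective : {m n : ℕ} (f : Fin m → Fin n) → (∀ {a b} → f a ≡ f b → a ≡ b) →
  ∀ a b → ⌊ f a ≟ f b ⌋ ≡ ⌊ a ≟ b ⌋
⌊≟⌋-injective f f-inj a b =
  trans (isYes≗does (f a ≟ f b))
        (trans (does-⇔ (mk⇔ f-inj (cong f)) (f a ≟ f b) (a ≟ b)) (sym (isYes≗does (a ≟ b))))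

module _ {m n : ℕ} (G : Graph m) (H : Graph n) where

  joinAdj-↑ˡ-↑ˡ : ∀ a b → joinAdj G H (a ↑ˡ n) (b ↑ˡ n) ≡ adj G a b
  joinAdj-↑ˡ-↑ˡ a b rewrite splitAt-↑ˡ m a n | splitAt-↑ˡ m b n = refl

  joinAdj-↑ʳ-↑ʳ : ∀ a b → joinAdj G H (m ↑ʳ a) (m ↑ʳ b) ≡ adj H a b
  joinAdj-↑ʳ-↑ʳ a b rewrite splitAt-↑ʳ m n a | splitAt-↑ʳ m n b = refl

  joinAdj-↑ˡ-↑ʳ : ∀ a b → joinAdj G H (a ↑ˡ n) (m ↑ʳ b) ≡ true
  joinAdj-↑ˡ-↑ʳ a b rewrite splitAt-↑ˡ m a n | splitAt-↑ʳ m n b = refl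

  joinAdj-↑ʳ-↑ˡ : ∀ b a → joinAdj G H (m ↑ʳ b) (a ↑ˡ n) ≡ true
  joinAdj-↑ʳ-↑ˡ b a rewrite splitAt-↑ˡ m a n | splitAt-↑ʳ m n b = refl

  inN-join-↑ˡ-↑ˡ : ∀ a b → inN (join G H) (a ↑ˡ n) (b ↑ˡ n) ≡ inN G a b
  inN-join-↑ˡ-↑ˡ a b =
    cong₂ _∨_ (⌊≟⌋-injective (_↑ˡ n) (↑ˡ-injective n _ _) b a) (joinAdj-↑ˡ-↑ˡ a b)

  inN-join-↑ʳ-↑ʳ : ∀ a b → inN (join G H) (m ↑ʳ a) (m ↑ʳ b) ≡ inN H a b
  inN-join-↑ʳ-↑ʳ a b =
    cong₂ _∨_ (⌊≟⌋-injective (m ↑ʳ_) (↑ʳ-injective m _ _) b a) (joinAdj-↑ʳ-↑ʳ a b)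

  inN-join-↑ˡ-↑ʳ : ∀ a b → inN (join G H) (a ↑ˡ n) (m ↑ʳ b) ≡ true
  inN-join-↑ˡ-↑ʳ a b = trans (cong (_ ∨_) (joinAdj-↑ˡ-↑ʳ a b)) (∨-zeroʳ _)

  inN-join-↑ʳ-↑ˡ : ∀ b a → inN (join G H) (m ↑ʳ b) (a ↑ˡ n) ≡ true
  inN-join-↑ʳ-↑ˡ b a = trans (cong (_ ∨_) (joinAdj-↑ʳ-↑ˡ b a)) (∨-zeroʳ _)

module _ {m n k : ℕ} where

  joinColoring : (Fin m → Fin k) → (Fin n → Fin k) → Fin (m + n) → Fin k
  joinColoring c c′ x = [ c , c′ ]′ (splitAt m x)

  joinColoring-↑ˡ : (c : Fin m → Fin k) (c′ : Fin n → Fin k) →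
    ∀ a → joinColoring c c′ (a ↑ˡ n) ≡ c a
  joinColoring-↑ˡ c c′ a rewrite splitAt-↑ˡ m a n = refl

  joinColoring-↑ʳ : (c : Fin m → Fin k) (c′ : Fin n → Fin k) →
    ∀ b → joinColoring c c′ (m ↑ʳ b) ≡ c′ b
  joinColoring-↑ʳ c c′ b rewrite splitAt-↑ʳ m n b = refl

module _ {m n k : ℕ} (G : Graph m) (H : Graph n) (c : Fin m → Fin k) (c′ : Fin n → Fin k) where

  private
    ⌊≟⌋-↑ˡ : ∀ i a → ⌊ joinColoring c c′ (a ↑ˡ n) ≟ i ⌋ ≡ ⌊ c a ≟ i ⌋
    ⌊≟⌋-↑ˡ i a = cong (λ z → ⌊ z ≟ i ⌋) (joinColoring-↑ˡ c c′ a)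

    ⌊≟⌋-↑ʳ : ∀ i b → ⌊ joinColoring c c′ (m ↑ʳ b) ≟ i ⌋ ≡ ⌊ c′ b ≟ i ⌋
    ⌊≟⌋-↑ʳ i b = cong (λ z → ⌊ z ≟ i ⌋) (joinColoring-↑ʳ c c′ b)

  nbhdColorCount-join-↑ˡ : ∀ a i →
    nbhdColorCount (join G H) (joinColoring c c′) (a ↑ˡ n) i
      ≡ nbhdColorCount G c a i + count (λ b → ⌊ c′ b ≟ i ⌋)
  nbhdColorCount-join-↑ˡ a i =
    trans (count-+ m _)
          (cong₂ _+_ (count-cong λ u → cong₂ _∧_ (inN-join-↑ˡ-↑ˡ G H a u) (⌊≟⌋-↑ˡ i u))
                     (count-cong λ u → cong₂ _∧_ (inN-join-↑ˡ-↑ʳ G H a u) (⌊≟⌋-↑ʳ i u)))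

  nbhdColorCount-join-↑ʳ : ∀ b i →
    nbhdColorCount (join G H) (joinColoring c c′) (m ↑ʳ b) i
      ≡ count (λ a → ⌊ c a ≟ i ⌋) + nbhdColorCount H c′ b i
  nbhdColorCount-join-↑ʳ b i =
    trans (count-+ m _)
          (cong₂ _+_ (count-cong λ u → cong₂ _∧_ (inN-join-↑ʳ-↑ˡ G H b u) (⌊≟⌋-↑ˡ i u))
                     (count-cong λ u → cong₂ _∧_ (inN-join-↑ʳ-↑ʳ G H b u) (⌊≟⌋-↑ʳ i u)))

  joinColoring-isCNB : IsCNBColoring G c → EqualClassSizes c →
    IsCNBColoring H c′ → EqualClassSizes c′ → IsCNBColoring (join G H) (joinColoring c c′)
  joinColoring-isCNB cnb eq cnb′ eq′ =
    ↑-elim (λ x → ∀ i j → N x i ≡ N x j)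
      (λ a i j → begin
        N (a ↑ˡ n) i                                          ≡⟨ nbhdColorCount-join-↑ˡ a i ⟩
        nbhdColorCount G c a i + count (λ b → ⌊ c′ b ≟ i ⌋)  ≡⟨ cong₂ _+_ (cnb a i j) (eq′ i j) ⟩
        nbhdColorCount G c a j + count (λ b → ⌊ c′ b ≟ j ⌋)  ≡⟨ sym (nbhdColorCount-join-↑ˡ a j) ⟩
        N (a ↑ˡ n) j                                          ∎)
      (λ b i j → begin
        N (m ↑ʳ b) i                                          ≡⟨ nbhdColorCount-join-↑ʳ b i ⟩
        count (λ a → ⌊ c a ≟ i ⌋) + nbhdColorCount H c′ b i  ≡⟨ cong₂ _+_ (eq i j) (cnb′ b i j) ⟩
        count (λ a → ⌊ c a ≟ j ⌋) + nbhdColorCount H c′ b j  ≡⟨ sym (nbhdColorCount-join-↑ʳ b j) ⟩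
        N (m ↑ʳ b) j                                          ∎)
    where
      open ≡-Reasoning
      N : Fin (m + n) → Fin k → ℕ
      N = nbhdColorCount (join G H) (joinColoring c c′)

theorem2p22 : (k : ℕ) → 2 ≤ k → {m n : ℕ} → (G : Graph m) → (H : Graph n)
    → Σ (Fin m → Fin k) (λ c → IsCNBColoring G c × EqualClassSizes c)
    → Σ (Fin n → Fin k) (λ c′ → IsCNBColoring H c′ × EqualClassSizes c′)
    → Σ (Fin (m + n) → Fin k) (λ d → IsCNBColoring (join G H) d)
theorem2p22 k _ G H (c , cnb , eq) (c′ , cnb′ , eq′) =
  joinColoring c c′ , joinColoring-isCNB G H c c′ cnb eq cnb′ eq′
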